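{- Let $\Gamma$ be a group acting by automorphisms on a tree $T$ with infinitely many ends, such that the action is quasi-transitive on $V(T)$ and $\Gamma$ stabilizes an end of $T$. Then the action of $\Gamma$ on $V(T)$ is not free.
   Context: An action is quasi-transitive if there are finitely many orbits on $V(T)$. A ray is a one-way infinite path; two rays are equivalent if there are infinitely many disjoint paths between them, and an end is an equivalence class of rays; automorphisms act on ends. The action is free if the only element stabilizing some vertex is the identity. -}

module Defs where

open import Level using (Level; _⊔_)
open import Data.Nat using (ℕ; suc; _≤_)
open import Data.Fin using (Fin)
open import Data.List using (List; length; head; last)
open import Data.Maybe using (just)
open import Data.Product using (Σ; _×_; ∃; ∃-syntax)
open import Data.Empty using (⊥)
open import Data.List.Relation.Unary.Linked using (Linked)
open import Data.List.Relation.Unary.Unique.Propositional using (Unique)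
open import Data.List.Membership.Propositional using (_∈_)
open import Relation.Nullary using (¬_)
open import Relation.Binary.PropositionalEquality using (_≡_; _≢_)
open import Algebra.Bundles using (Group)

module _ {a e : Level} {V : Set a} (E : V → V → Set e) where

  IsPath : List V → Set (a ⊔ e)
  IsPath xs = Linked E xs × Unique xs

  IsPathFromTo : V → V → List V → Set (a ⊔ e)
  IsPathFromTo u v xs = IsPath xs × head xs ≡ just u × last xs ≡ just v

  IsCycle : List V → Set (a ⊔ e)
  IsCycle xs = IsPath xs × 3 ≤ length xs
             × Σ V (λ u → Σ V (λ v → head xs ≡ just u × last xs ≡ just v × E v u))

  record IsSimpleGraph : Set (a ⊔ e) where
    field
      sym   : ∀ {u v} → E u v → E v u
      irrefl : ∀ {u} → ¬ E u u

  record IsTree : Set (a ⊔ e) where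
    field
      simple    : IsSimpleGraph
      connected : ∀ u v → Σ (List V) (IsPathFromTo u v)
      acyclic   : ∀ xs → ¬ IsCycle xs

  record Ray : Set (a ⊔ e) where
    field
      seq : ℕ → V
      adj : ∀ n → E (seq n) (seq (suc n))
      inj : ∀ m n → seq m ≡ seq n → m ≡ n
  open Ray public

  IsPathBetween : (ℕ → V) → (ℕ → V) → List V → Set (a ⊔ e)
  IsPathBetween r s xs = Σ ℕ λ i → Σ ℕ λ j → IsPathFromTo (r i) (s j) xs

  -- r and s are equivalent: there are infinitely many (pairwise vertex-)
  -- disjoint paths between them, i.e. for every n there are n such paths
  Equivalent : (ℕ → V) → (ℕ → V) → Set (a ⊔ e)
  Equivalent r s = ∀ n → Σ (Fin n → List V) λ P →
                     (∀ i → IsPathBetween r s (P i))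
                   × (∀ i j → i ≢ j → ∀ x → x ∈ P i → x ∈ P j → ⊥)

  -- the graph has infinitely many ends: for every n there are n pairwise
  -- inequivalent rays (i.e. n pairwise distinct ends)
  InfinitelyManyEnds : Set (a ⊔ e)
  InfinitelyManyEnds = ∀ n → Σ (Fin n → Ray) λ R →
                         ∀ i j → i ≢ j → ¬ Equivalent (seq (R i)) (seq (R j))

module _ {c ℓ a e : Level} (Γ : Group c ℓ) {V : Set a} (E : V → V → Set e) where
  open Group Γ

  record ActionByAutomorphisms : Set (c ⊔ ℓ ⊔ a ⊔ e) where
    field
      act      : Carrier → V → V
      act-ε    : ∀ v → act ε v ≡ v
      act-∙    : ∀ g h v → act (g ∙ h) v ≡ act g (act h v)
      act-cong : ∀ {g h} → g ≈ h → ∀ v → act g v ≡ act h v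
      act-adj  : ∀ g {u v} → E u v → E (act g u) (act g v)

  module _ (A : ActionByAutomorphisms) where
    open ActionByAutomorphisms A

    QuasiTransitive : Set (c ⊔ a)
    QuasiTransitive = Σ ℕ λ n → Σ (Fin n → V) λ rep →
                        ∀ v → Σ (Fin n) λ i → Σ Carrier λ g → act g (rep i) ≡ v

    StabilizesAnEnd : Set (c ⊔ a ⊔ e)
    StabilizesAnEnd = Σ (Ray E) λ R →
                        ∀ g → Equivalent E (λ n → act g (Ray.seq R n)) (Ray.seq R)

    Free : Set (c ⊔ ℓ ⊔ a)
    Free = ∀ g v → act g v ≡ v → g ≈ ε

{-# OPTIONS --safe #-}
module Submission where

-- Let ρ be a ray in the end fixed by Γ. The distances to the far points of ρ define horospheres
-- (level sets of the Busemann function). Each g maps ρ to a ray sharing a tail with ρ, so g shifts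
-- all horospheres by one amount; if g preserves a horosphere it fixes a vertex of ρ, so in a free
-- action each horosphere meets each of the n orbits at most once. On the other hand, among n + 2
-- rays in distinct ends at most one converges to the end of ρ, and the other n + 1 eventually climb
-- away from it one level per step. A vertex has only one neighbour towards the end of ρ, so two
-- climbing rays that differ on some level differ on all higher ones; high enough, the n + 1 rays
-- therefore give n + 1 distinct vertices on one horosphere, which is impossible.
-- Classical case distinctions are made under double negation, which suffices because the goal is ⊥.

open import Defs
open import Level using (Level; _⊔_)
open import Algebra.Bundles using (Group)
open import Data.Nat using (ℕ; zero; suc; _+_; _∸_; _≤_; _≟_; _≤?_; s≤s)
open import Data.Nat.Properties
open import Algebra.Properties.CommutativeSemigroup +-commutativeSemigroup
  using (xy∙z≈x∙zy; xy∙z≈xz∙y; x∙yz≈y∙xz)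
open import Data.Fin using (Fin; toℕ)
import Data.Fin as Fin
import Data.Fin.Properties as Finₚ
open import Data.Product using (Σ; _×_; _,_; proj₁; proj₂)
open import Data.Sum using (_⊎_; inj₁; inj₂; [_,_]′)
open import Data.Empty using (⊥; ⊥-elim)
open import Data.Maybe using (just)
open import Data.List using (List; []; _∷_; _++_; [_]; length; last; applyDownFrom)
import Data.List as List
open import Data.List.Properties using (length-++; length-applyDownFrom; length-map; last-map)
import Data.Maybe as Maybe
import Data.List.Relation.Unary.Linked as Linked
import Data.List.Relation.Unary.Linked.Properties as Linkedₚ
import Data.List.Relation.Unary.Unique.Propositional.Properties as Uniqueₚ
open import Data.List.Relation.Unary.Linked using (Linked; [-]; _∷_)
open import Data.List.Relation.Unary.AllPairs using (_∷_; [])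
open import Data.List.Relation.Unary.All using ([]; _∷_)
open import Data.List.Relation.Unary.All.Properties using (¬Any⇒All¬; All¬⇒¬Any)
open import Data.List.Relation.Unary.Any using (here; there)
import Data.List.Relation.Unary.Any as Any
open import Data.List.Relation.Unary.Any.Properties using (lookup-index)
open import Data.List.Relation.Unary.Unique.Propositional using (Unique)
open import Data.List.Membership.Propositional using (_∈_; _∉_)
open import Data.List.Membership.Propositional.Properties
  using (∈-∃++; ∈-++⁻; ∈-++⁺ˡ; ∈-++⁺ʳ; ∈-applyDownFrom⁺; ∈-applyDownFrom⁻)
open import Data.List.Relation.Binary.Subset.Propositional using (_⊆_)
open import Data.List.Relation.Binary.Subset.Propositional.Properties using (++⁺ʳ; xs⊆xs++ys)
open import Function using (_∘_; id)
open import Relation.Nullary using (¬_; Dec; yes; no)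
open import Relation.Nullary.Decidable using (decidable-stable; _⊎-dec_; ¬?; ¬¬-excluded-middle)
open import Relation.Binary.PropositionalEquality hiding ([_])

infixl 1 _>>=_

_>>=_ : ∀ {p q} {P : Set p} {Q : Set q} → ¬ ¬ P → (P → ¬ ¬ Q) → ¬ ¬ Q
(m >>= f) k = m λ x → f x k

pure : ∀ {p} {P : Set p} → P → ¬ ¬ P
pure x k = k x

¬¬-Π-Fin : ∀ {p} n {P : Fin n → Set p} → (∀ i → ¬ ¬ P i) → ¬ ¬ (∀ i → P i)
¬¬-Π-Fin zero    h k = k λ ()
¬¬-Π-Fin (suc n) h = do
  p₀ ← h Fin.zero
  ps ← ¬¬-Π-Fin n (h ∘ Fin.suc)
  pure λ { Fin.zero → p₀ ; (Fin.suc i) → ps i }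

¬¬-→ : ∀ {p q} {P : Set p} {Q : Set q} → (P → ¬ ¬ Q) → ¬ ¬ (P → Q)
¬¬-→ f k = k λ p → ⊥-elim (f p λ q → k λ _ → q)

≡-stable : {m n : ℕ} → ¬ ¬ (m ≡ n) → m ≡ n
≡-stable = decidable-stable (_ ≟ _)

record Eventually {p} (P : ℕ → Set p) : Set p where
  constructor _,_
  field
    start : ℕ
    holds : ∀ k → P (k + start)

open Eventually

eventually-∧ : ∀ {p q} {P : ℕ → Set p} {Q : ℕ → Set q} →
               Eventually P → Eventually Q → Eventually (λ m → P m × Q m)
eventually-∧ {P = P} {Q} (K , p) (K′ , q) = K + K′ , λ k →
  subst P (xy∙z≈x∙zy k K′ K) (p (k + K′)) , subst Q (+-assoc k K K′) (q (k + K))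

eventually-→ : ∀ {p q} {P : Set p} {Q : ℕ → Set q} →
               Dec P → (P → Eventually Q) → Eventually (λ m → P → Q m)
eventually-→ (yes p) f = start (f p) , λ k _ → holds (f p) k
eventually-→ (no ¬p) f = 0 , λ k p → ⊥-elim (¬p p)

eventually-∀-Fin : ∀ {p} {n} {P : Fin n → ℕ → Set p} →
                   (∀ i → Eventually (P i)) → Eventually (λ m → ∀ i → P i m)
eventually-∀-Fin {n = zero}  h = 0 , λ k ()
eventually-∀-Fin {n = suc n} {P} h
  with K , both ← eventually-∧ (h Fin.zero) (eventually-∀-Fin {P = P ∘ Fin.suc} (h ∘ Fin.suc)) =
  K , λ { k Fin.zero → proj₁ (both k) ; k (Fin.suc i) → proj₂ (both k) i }

finite-separator⇒inequivalent :
  ∀ {a e} {V : Set a} (E : V → V → Set e) {s s′ : ℕ → V} (F : List V) →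
  (∀ xs → IsPathBetween E s s′ xs → ¬ ¬ (Σ V λ x → x ∈ F × x ∈ xs)) →
  ¬ Equivalent E s s′
finite-separator⇒inequivalent {V = V} E F meets equivalent
  with P , between , disjoint ← equivalent (suc (length F)) =
  ¬¬-Π-Fin _ (λ t → meets (P t) (between t)) λ hit →
    collide (proj₁ ∘ hit) (proj₁ ∘ proj₂ ∘ hit) (proj₂ ∘ proj₂ ∘ hit)
  where
  collide : (x : Fin (suc (length F)) → V) → (∀ t → x t ∈ F) → (∀ t → x t ∈ P t) → ⊥
  collide x x∈F x∈P with t , t′ , t<t′ , same ← Finₚ.pigeonhole (n<1+n _) (Any.index ∘ x∈F) =
    disjoint t t′ (Finₚ.<⇒≢ t<t′) (x t) (x∈P t) (subst (_∈ P t′) x′≡x (x∈P t′))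
    where
    x′≡x : x t′ ≡ x t
    x′≡x = trans (lookup-index (x∈F t′))
                 (trans (cong (List.lookup F) (sym same)) (sym (lookup-index (x∈F t))))

module TreeGeometry {a e} {V : Set a} {E : V → V → Set e} (tree : IsTree E) where
  open IsTree tree
  open IsSimpleGraph simple renaming (sym to E-sym)

  private variable
    u v w x y z q : V
    xs ys zs : List V
    k L M : ℕ

  -- u ∷ xs is a path from u to v; length xs is its number of edges
  Path : V → V → List V → Set (a ⊔ e)
  Path u v xs = Linked E (u ∷ xs) × Unique (u ∷ xs) × last (u ∷ xs) ≡ just v

  path-tail : Path u v (q ∷ xs) → Path q v xs
  path-tail (_ ∷ lk , _ ∷ un , l) = lk , un , l

  path-first-edge : Path u v (q ∷ xs) → E u q
  path-first-edge (e ∷ _ , _) = e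

  path-start-fresh : Path u v xs → u ∉ xs
  path-start-fresh (_ , u∉ ∷ _ , _) = All¬⇒¬Any u∉

  path-end : Path u v [] → u ≡ v
  path-end (_ , _ , refl) = refl

  path-end-∈ : Path u v xs → v ∈ u ∷ xs
  path-end-∈ {xs = []}     p = here (sym (path-end p))
  path-end-∈ {xs = _ ∷ _} p = there (path-end-∈ (path-tail p))

  path-cons : E x u → x ∉ xs → Path u v xs → Path x v (u ∷ xs)
  path-cons x~u x∉ (lk , un , l) = x~u ∷ lk , ¬Any⇒All¬ _ x∉u∷ ∷ un , l
    where
    x∉u∷ : _ ∉ _ ∷ _
    x∉u∷ (here refl) = irrefl x~u
    x∉u∷ (there x∈) = x∉ x∈

  path-snoc : Path u v xs → E v w → w ∉ u ∷ xs → Path u w (xs ++ [ w ])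
  path-snoc {xs = []} p v~w w∉ with refl ← path-end p =
    v~w ∷ [-] , ((λ v≡w → w∉ (here (sym v≡w))) ∷ []) ∷ [] ∷ [] , refl
  path-snoc {u = u} {xs = q ∷ xs} {w = w} p v~w w∉ =
    path-cons (path-first-edge p) u∉ (path-snoc (path-tail p) v~w (w∉ ∘ there))
    where
    u∉ : u ∉ xs ++ [ w ]
    u∉ u∈ with ∈-++⁻ xs u∈
    ... | inj₁ u∈xs       = path-start-fresh p (there u∈xs)
    ... | inj₂ (here u≡w) = w∉ (here (sym u≡w))

  path-prefix : ∀ ws → Path u v (ws ++ x ∷ ys) → Path u x (ws ++ [ x ])
  path-prefix [] (u~x ∷ _ , (u≢x ∷ _) ∷ _ , _) =
    u~x ∷ [-] , (u≢x ∷ []) ∷ [] ∷ [] , refl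
  path-prefix {x = x} {ys = ys} (w ∷ ws) p =
    path-cons (path-first-edge p) (path-start-fresh p ∘ there ∘ ++⁺ʳ ws (xs⊆xs++ys [ x ] ys))
              (path-prefix ws (path-tail p))

  closed-path-trivial : Path u u xs → xs ≡ []
  closed-path-trivial {xs = []}    _ = refl
  closed-path-trivial {xs = _ ∷ _} p = ⊥-elim (path-start-fresh p (path-end-∈ (path-tail p)))

  neighbour-on-path-is-next : Path y v (q ∷ zs) → E x y → x ∈ q ∷ zs → x ≡ q
  neighbour-on-path-is-next p x~y (here x≡q) = x≡q
  neighbour-on-path-is-next {y = y} {q = q} {x = x} p x~y (there x∈zs)
    with ws , _ , refl ← ∈-∃++ x∈zs =
    ⊥-elim (acyclic (y ∷ q ∷ ws ++ [ x ]) (closing (path-prefix (q ∷ ws) p)))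
    where
    closing : Path y x (q ∷ ws ++ [ x ]) → IsCycle E (y ∷ q ∷ ws ++ [ x ])
    closing (lk , un , l) =
      (lk , un) , s≤s (s≤s (subst (1 ≤_) (sym (length-++ ws)) (m≤n+m 1 (length ws)))) ,
      y , x , refl , l , x~y

  -- if the second vertex x of the first path avoids the second path, then x ∷ u ∷ y ∷ ys is a path
  -- from x, so the tail of the first path would have to contain u
  path-unique : Path u v xs → Path u v ys → ¬ ¬ (xs ≡ ys)
  path-unique {xs = []} p p′ with refl ← path-end p = pure (sym (closed-path-trivial p′))
  path-unique {ys = []} p p′ with refl ← path-end p′ = pure (closed-path-trivial p)
  path-unique {u = u} {xs = x ∷ xs} {ys = y ∷ ys} p p′ = ¬¬-excluded-middle >>= λ where
    (yes x∈) → do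
      let x≡y = neighbour-on-path-is-next p′ (E-sym (path-first-edge p)) x∈
      xs≡ys ← path-unique (path-tail p) (subst (λ w → Path w _ ys) (sym x≡y) (path-tail p′))
      pure (cong₂ _∷_ x≡y xs≡ys)
    (no x∉) → do
      xs≡ ← path-unique (path-tail p) (path-cons (E-sym (path-first-edge p)) x∉ p′)
      λ _ → path-start-fresh p (there (subst (u ∈_) (sym xs≡) (here refl)))

  IsPathFromTo⇒Path : IsPathFromTo E u v ys → Σ (List V) λ xs → ys ≡ u ∷ xs × Path u v xs
  IsPathFromTo⇒Path {ys = _ ∷ xs} ((lk , un) , refl , l) = xs , refl , lk , un , l

  geodesic : ∀ u v → Σ (List V) (Path u v)
  geodesic u v with xs , _ , p ← IsPathFromTo⇒Path (proj₂ (connected u v)) = xs , p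

  dist : V → V → ℕ
  dist u v = length (proj₁ (geodesic u v))

  path-length : Path u v xs → length xs ≡ dist u v
  path-length p = ≡-stable (λ ≢ → path-unique p (proj₂ (geodesic _ _)) (≢ ∘ cong length))

  dist-via-next : Path u v (q ∷ xs) → dist u v ≡ suc (dist q v)
  dist-via-next p = trans (sym (path-length p)) (cong suc (path-length (path-tail p)))

  dist≡0⇒≡ : dist u v ≡ 0 → u ≡ v
  dist≡0⇒≡ {u} {v} = via (proj₂ (geodesic u v))
    where
    via : Path u v xs → length xs ≡ 0 → u ≡ v
    via {[]} p _ = path-end p

  path-reverse : Path u v xs →
                 Σ (List V) λ ys → Path v u ys × length ys ≡ length xs × v ∷ ys ⊆ u ∷ xs
  path-reverse {xs = []} p with refl ← path-end p = [] , p , refl , λ v∈ → v∈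
  path-reverse {u = u} {xs = q ∷ xs} p
    with ys , p′ , len , ⊆q∷xs ← path-reverse (path-tail p) =
    ys ++ [ u ] ,
    path-snoc p′ (E-sym (path-first-edge p)) (path-start-fresh p ∘ ⊆q∷xs) ,
    trans (length-++ ys) (trans (+-comm (length ys) 1) (cong suc len)) ,
    ⊆u∷q∷xs
    where
    ⊆u∷q∷xs : _ ∷ ys ++ [ u ] ⊆ u ∷ q ∷ xs
    ⊆u∷q∷xs w∈ with ∈-++⁻ (_ ∷ ys) w∈
    ... | inj₁ w∈ys      = there (⊆q∷xs w∈ys)
    ... | inj₂ (here eq) = here eq

  dist-sym : ∀ u v → dist u v ≡ dist v u
  dist-sym u v with ys , p , len , _ ← path-reverse (proj₂ (geodesic u v)) =
    trans (sym len) (path-length p)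

  dist-adjacent : ∀ z → E x y → dist x z ≡ suc (dist y z) ⊎ dist y z ≡ suc (dist x z)
  dist-adjacent {x} {y} z x~y =
    decidable-stable (_ ≟ _ ⊎-dec _ ≟ _) (¬¬-excluded-middle >>= pure ∘ by-membership)
    where
    γ : Σ (List V) (Path y z)
    γ = geodesic y z
    x-next : Path y z ys → x ∈ ys → dist y z ≡ suc (dist x z)
    x-next {_ ∷ _} p x∈ with refl ← neighbour-on-path-is-next p x~y x∈ = dist-via-next p
    by-membership : Dec (x ∈ proj₁ γ) →
                    dist x z ≡ suc (dist y z) ⊎ dist y z ≡ suc (dist x z)
    by-membership (yes x∈) = inj₂ (x-next (proj₂ γ) x∈)
    by-membership (no x∉)  = inj₁ (dist-via-next (path-cons x~y x∉ (proj₂ γ)))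

  closer-neighbour-is-next : E x y → suc (dist y z) ≡ dist x z → Path x z (q ∷ zs) →
                             ¬ ¬ (y ≡ q)
  closer-neighbour-is-next x~y closer p = ¬¬-excluded-middle >>= λ where
    (yes y∈) → pure (neighbour-on-path-is-next p (E-sym x~y) y∈)
    (no y∉)  → λ _ → m≢1+n+m _
      (trans (sym closer) (cong suc (dist-via-next (path-cons (E-sym x~y) y∉ p))))

  closer-neighbour-unique : E x y → E x w →
                            suc (dist y z) ≡ dist x z → suc (dist w z) ≡ dist x z → ¬ ¬ (y ≡ w)
  closer-neighbour-unique {x} {z = z} x~y x~w y-closer w-closer = via (proj₂ (geodesic x z))
    where
    via : Path x z xs → ¬ ¬ (_ ≡ _)
    via {[]}    p = λ _ → 0≢1+n (trans (path-length p) (sym y-closer))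
    via {_ ∷ _} p = do
      y≡q ← closer-neighbour-is-next x~y y-closer p
      w≡q ← closer-neighbour-is-next x~w w-closer p
      pure (trans y≡q (sym w≡q))

  path-triangle : ∀ z → Path x y xs → dist x z ≤ length xs + dist y z
  path-triangle {xs = []} z p with refl ← path-end p = ≤-refl
  path-triangle {xs = q ∷ xs} z p with dist-adjacent z (path-first-edge p)
  ... | inj₁ x-farther = ≤-trans (≤-reflexive x-farther) (s≤s (path-triangle z (path-tail p)))
  ... | inj₂ x-closer  = ≤-trans (n≤1+n _)
    (≤-trans (≤-reflexive (sym x-closer)) (m≤n⇒m≤1+n (path-triangle z (path-tail p))))

  dist-triangle : ∀ x y z → dist x z ≤ dist x y + dist y z
  dist-triangle x y z = subst (λ n → dist x z ≤ n + dist y z) (path-length p) (path-triangle z p)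
    where
    p : Path x y (proj₁ (geodesic x y))
    p = proj₂ (geodesic x y)

  geodesic-next-closer : Path u w (q ∷ zs) →
                         dist u v ≡ suc k → dist u w ≡ suc (k + dist v w) → dist q v ≡ k
  geodesic-next-closer {u} {w} {q} {v = v} {k} p uv uw = via (proj₂ (geodesic u v))
    where
    via : Path u v ys → dist q v ≡ k
    via {[]} p′ = ⊥-elim (0≢1+n (trans (path-length p′) uv))
    via {q′ ∷ _} p′ = ≡-stable do
        q′≡q ← closer-neighbour-is-next (path-first-edge p′) q′-closer p
        pure (subst (λ x → dist x v ≡ k) q′≡q q′v)
      where
      q′v : dist q′ v ≡ k
      q′v = suc-injective (trans (sym (dist-via-next p′)) uv)
      q′-closer : suc (dist q′ w) ≡ dist u w
      q′-closer with dist-adjacent w (path-first-edge p′)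
      ... | inj₁ u-farther = sym u-farther
      ... | inj₂ q′-farther = ⊥-elim (1+n≰n (≤-trans (n≤1+n _) too-close))
        where
        open ≤-Reasoning
        too-close : suc (suc (k + dist v w)) ≤ k + dist v w
        too-close = begin
          suc (suc (k + dist v w)) ≡⟨ cong suc uw ⟨
          suc (dist u w)           ≡⟨ q′-farther ⟨
          dist q′ w                ≤⟨ dist-triangle q′ v w ⟩
          dist q′ v + dist v w     ≡⟨ cong (_+ dist v w) q′v ⟩
          k + dist v w             ∎

  -- the k-th vertex of u ∷ xs, or its last vertex if k is too large
  vertex-at : ℕ → V → List V → V
  vertex-at zero    u _        = u
  vertex-at (suc k) u []       = u
  vertex-at (suc k) u (q ∷ xs) = vertex-at k q xs

  vertex-at-∈ : ∀ k → vertex-at k u xs ∈ u ∷ xs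
  vertex-at-∈ zero                = here refl
  vertex-at-∈ {xs = []}    (suc k) = here refl
  vertex-at-∈ {xs = _ ∷ _} (suc k) = there (vertex-at-∈ k)

  on-geodesic : Path u w zs → dist u v ≡ k → dist u w ≡ k + dist v w →
                ¬ ¬ (v ≡ vertex-at k u zs)
  on-geodesic {k = zero}                p uv uw = pure (sym (dist≡0⇒≡ uv))
  on-geodesic {zs = []}     {k = suc k} p uv uw = ⊥-elim (0≢1+n (trans (path-length p) uw))
  on-geodesic {zs = q ∷ zs} {k = suc k} p uv uw =
    on-geodesic (path-tail p) (geodesic-next-closer p uv uw)
      (suc-injective (trans (sym (dist-via-next p)) uw))

  between-unique : dist u v ≡ k → dist u w ≡ k + dist v w →
                   dist u y ≡ k → dist u w ≡ k + dist y w → ¬ ¬ (v ≡ y)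
  between-unique {u} {w = w} uv uw uy uw′ = do
    v≡ ← on-geodesic (proj₂ (geodesic u w)) uv uw
    y≡ ← on-geodesic (proj₂ (geodesic u w)) uy uw′
    pure (trans v≡ (sym y≡))

  on-path-between-equal : IsPathFromTo E u v ys → u ≡ v → x ∈ ys → x ≡ u
  on-path-between-equal pft refl x∈ with _ , refl , p ← IsPathFromTo⇒Path pft =
    on-trivial (closed-path-trivial p) x∈
    where
    on-trivial : xs ≡ [] → x ∈ u ∷ xs → x ≡ u
    on-trivial refl (here x≡u) = x≡u

  SameTail : (ℕ → V) → (ℕ → V) → Set a
  SameTail s s′ = Σ ℕ λ D → Σ ℕ λ K → ∀ k → ¬ ¬ (s (k + D) ≡ s′ (k + K))

  same-tail-via : ∀ {s s′ r : ℕ → V} → SameTail s r → SameTail s′ r → SameTail s s′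
  same-tail-via {s} {s′} {r} (D , K , tail) (D′ , K′ , tail′) = K′ + D , K + D′ , λ k → do
    e  ← tail (k + K′)
    e′ ← tail′ (k + K)
    pure (begin
      s (k + (K′ + D))   ≡⟨ cong s (+-assoc k K′ D) ⟨
      s (k + K′ + D)     ≡⟨ e ⟩
      r (k + K′ + K)     ≡⟨ cong r (xy∙z≈xz∙y k K′ K) ⟩
      r (k + K + K′)     ≡⟨ e′ ⟨
      s′ (k + K + D′)    ≡⟨ cong s′ (+-assoc k K D′) ⟩
      s′ (k + (K + D′))  ∎)
    where open ≡-Reasoning

  -- the common vertices σ (t + D) ≡ s′ (t + K) are pairwise distinct, hence disjoint trivial paths
  same-tail⇒equivalent : ∀ (σ : Ray E) {s′ : ℕ → V} →
                         SameTail (seq σ) s′ → Equivalent E (seq σ) s′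
  same-tail⇒equivalent σ {s′} (D , K , tail) n =
    (λ i → proj₁ (trivial i)) , (λ i → toℕ i + D , toℕ i + K , proj₂ (trivial i)) , disjoint
    where
    trivial : ∀ (i : Fin n) → Σ (List V) (IsPathFromTo E (seq σ (toℕ i + D)) (s′ (toℕ i + K)))
    trivial i = connected _ _
    disjoint : ∀ i j → i ≢ j → ∀ x → x ∈ proj₁ (trivial i) → x ∈ proj₁ (trivial j) → ⊥
    disjoint i j i≢j x x∈i x∈j = tail (toℕ i) λ meetᵢ → tail (toℕ j) λ meetⱼ →
      i≢j (Finₚ.toℕ-injective (+-cancelʳ-≡ D _ _ (inj σ _ _
        (trans (sym (on-path-between-equal (proj₂ (trivial i)) meetᵢ x∈i))
               (on-path-between-equal (proj₂ (trivial j)) meetⱼ x∈j)))))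

  module RayGeometry (σ : Ray E) where
    private
      s : ℕ → V
      s = seq σ

    dist-along-ray : ∀ k i → dist (s (k + i)) (s i) ≡ k
    dist-along-ray k i = trans (sym (path-length (descent k))) (length-applyDownFrom _ k)
      where
      descent : ∀ k → Path (s (k + i)) (s i) (applyDownFrom (λ j → s (j + i)) k)
      descent zero    = [-] , [] ∷ [] , refl
      descent (suc k) = path-cons (E-sym (adj σ (k + i))) fresh (descent k)
        where
        fresh : s (suc k + i) ∉ applyDownFrom (λ j → s (j + i)) k
        fresh s∈ with j , j<k , eq ← ∈-applyDownFrom⁻ _ s∈ =
          <⇒≢ (m<n⇒m<1+n j<k) (sym (+-cancelʳ-≡ i _ _ (inj σ _ _ eq)))

    Receding : V → ℕ → Set
    Receding z i = dist (s (suc i)) z ≡ suc (dist (s i) z)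

    receding-suc : Receding z k → Receding z (suc k)
    receding-suc {z} {i} receding with dist-adjacent z (E-sym (adj σ (suc i)))
    ... | inj₁ farther = farther
    ... | inj₂ closer  =
      ⊥-elim (closer-neighbour-unique (E-sym (adj σ i)) (adj σ (suc i)) (sym receding) (sym closer)
                λ s≡s → m≢1+n+m i (inj σ _ _ s≡s))

    receding-from : Receding z k → ∀ j → Receding z (j + k)
    receding-from receding zero    = receding
    receding-from receding (suc j) = receding-suc (receding-from receding j)

    receding-dist : Receding z k → ∀ j → dist (s (j + k)) z ≡ j + dist (s k) z
    receding-dist receding zero    = refl
    receding-dist receding (suc j) =
      trans (receding-from receding j) (cong suc (receding-dist receding j))

  open RayGeometry

  module Horospheres (ρ : Ray E) where
    private
      r : ℕ → V
      r = seq ρ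

    -- x lies on the horosphere of Busemann level L − M about the end of ρ, and from ρ M on
    -- the ray moves straight away from x
    OnHorosphere : V → ℕ → ℕ → Set
    OnHorosphere x M L = ∀ j → dist x (r (j + M)) ≡ j + L

    on-horosphere-later : OnHorosphere x M L → ∀ i → OnHorosphere x (i + M) (i + L)
    on-horosphere-later {x} {M} {L} h i j = begin
      dist x (r (j + (i + M))) ≡⟨ cong (dist x ∘ r) (+-assoc j i M) ⟨
      dist x (r (j + i + M))   ≡⟨ h (j + i) ⟩
      j + i + L                ≡⟨ +-assoc j i L ⟩
      j + (i + L)              ∎
      where open ≡-Reasoning

    on-horosphere-onwards : OnHorosphere x M (dist x (r M)) →
                            Eventually (λ M → OnHorosphere x M (dist x (r M)))
    on-horosphere-onwards {x} {M} h =
      M , λ i → subst (OnHorosphere x (i + M)) (sym (h i)) (on-horosphere-later h i)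

    eventually-on-horosphere : ∀ x → Eventually (λ M → OnHorosphere x M (dist x (r M)))
    eventually-on-horosphere x = on-horosphere-onwards (proj₂ (search (dist (r 0) x) 0 refl))
      where
      -- while ρ approaches x, dist (r K) x drops by one per step: at most dist (r 0) x steps
      search : ∀ n K → dist (r K) x ≡ n → Σ ℕ λ M → OnHorosphere x M (dist x (r M))
      search n K eq with dist-adjacent x (adj ρ K)
      search n       K eq | inj₂ away   = K , λ j → begin
        dist x (r (j + K))   ≡⟨ dist-sym x _ ⟩
        dist (r (j + K)) x   ≡⟨ receding-dist ρ away j ⟩
        j + dist (r K) x     ≡⟨ cong (j +_) (dist-sym _ x) ⟩
        j + dist x (r K)     ∎
        where open ≡-Reasoning
      search zero    K eq | inj₁ toward = ⊥-elim (0≢1+n (trans (sym eq) toward))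
      search (suc n) K eq | inj₁ toward = search n (suc K) (suc-injective (trans (sym toward) eq))

    one-level-above : OnHorosphere x M L → OnHorosphere y M (suc L) →
                      ∀ k → dist y (r (k + M)) ≡ suc (dist x (r (k + M)))
    one-level-above {L = L} hx hy k = trans (hy k) (trans (+-suc k L) (cong suc (sym (hx k))))

    module _ (σ : Ray E) where
      private
        s : ℕ → V
        s = seq σ

      StepsAway StepsToward : ℕ → Set
      StepsAway   i = Eventually λ m → dist (s (suc i)) (r m) ≡ suc (dist (s i) (r m))
      StepsToward i = Eventually λ m → suc (dist (s (suc i)) (r m)) ≡ dist (s i) (r m)

      Diverges Converges : Set
      Diverges  = Σ ℕ StepsAway
      Converges = ∀ i → StepsToward i

      steps-away-or-toward : ∀ i → StepsAway i ⊎ StepsToward i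
      steps-away-or-toward i = from-level (holds both 0) (dist-adjacent (r M₀) (adj σ i))
        where
        both : Eventually λ M → OnHorosphere (s i) M (dist (s i) (r M)) ×
                                OnHorosphere (s (suc i)) M (dist (s (suc i)) (r M))
        both = eventually-∧ (eventually-on-horosphere (s i)) (eventually-on-horosphere (s (suc i)))
        M₀ dᵢ dᵢ₊₁ : ℕ
        M₀ = start both
        dᵢ = dist (s i) (r M₀)
        dᵢ₊₁ = dist (s (suc i)) (r M₀)
        from-level : OnHorosphere (s i) M₀ dᵢ × OnHorosphere (s (suc i)) M₀ dᵢ₊₁ →
                     dᵢ ≡ suc dᵢ₊₁ ⊎ dᵢ₊₁ ≡ suc dᵢ → StepsAway i ⊎ StepsToward i
        from-level (hᵢ , hᵢ₊₁) (inj₁ toward) =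
          inj₂ (M₀ , λ k → sym (one-level-above hᵢ₊₁ (subst (OnHorosphere (s i) M₀) toward hᵢ) k))
        from-level (hᵢ , hᵢ₊₁) (inj₂ away) =
          inj₁ (M₀ , one-level-above hᵢ (subst (OnHorosphere (s (suc i)) M₀) away hᵢ₊₁))

      ¬diverges⇒converges : ¬ Diverges → Converges
      ¬diverges⇒converges ¬diverges i =
        [ (λ away → ⊥-elim (¬diverges (i , away))) , id ]′ (steps-away-or-toward i)

      converges⇒approaches : Converges →
                             ∀ n → Eventually (λ m → n + dist (s n) (r m) ≡ dist (s 0) (r m))
      converges⇒approaches converges zero = 0 , λ _ → refl
      converges⇒approaches converges (suc n)
        with K , both ← eventually-∧ (converges n) (converges⇒approaches converges n) = K , λ k →
          let step , approach = both k in trans (sym (+-suc n _)) (trans (cong (n +_) step) approach)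

      -- σ (k + D) and ρ (k + K) both lie on the geodesic from a far point ρ M′ to σ 0,
      -- at distance B from ρ M′
      converges⇒same-tail : Converges → SameTail s r
      converges⇒same-tail converges = D , K , meet
        where
        K D : ℕ
        K = start (eventually-on-horosphere (s 0))
        D = dist (s 0) (r K)
        h : OnHorosphere (s 0) K D
        h = holds (eventually-on-horosphere (s 0)) 0
        meet : ∀ k → ¬ ¬ (s (k + D) ≡ r (k + K))
        meet k = between-unique ray-side ray-total base-side base-total
          where
          open ≡-Reasoning
          approach : Eventually λ m → k + D + dist (s (k + D)) (r m) ≡ dist (s 0) (r m)
          approach = converges⇒approaches converges (k + D)
          B M′ : ℕ
          B = start approach
          M′ = k + K + B
          s₀-far : dist (s 0) (r M′) ≡ B + (k + D)
          s₀-far = begin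
            dist (s 0) (r (k + K + B)) ≡⟨ cong (dist (s 0) ∘ r) (xy∙z≈xz∙y k K B) ⟩
            dist (s 0) (r (k + B + K)) ≡⟨ h (k + B) ⟩
            k + B + D                  ≡⟨ cong (_+ D) (+-comm k B) ⟩
            B + k + D                  ≡⟨ +-assoc B k D ⟩
            B + (k + D)                ∎
          ray-side : dist (r M′) (s (k + D)) ≡ B
          ray-side = +-cancelˡ-≡ (k + D) _ _ (begin
            k + D + dist (r M′) (s (k + D)) ≡⟨ cong (k + D +_) (dist-sym _ _) ⟩
            k + D + dist (s (k + D)) (r M′) ≡⟨ holds approach (k + K) ⟩
            dist (s 0) (r M′)               ≡⟨ s₀-far ⟩
            B + (k + D)                     ≡⟨ +-comm B _ ⟩
            k + D + B                       ∎)
          ray-total : dist (r M′) (s 0) ≡ B + dist (s (k + D)) (s 0)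
          ray-total = trans (dist-sym _ _) (trans s₀-far (cong (B +_) (sym along-σ)))
            where
            along-σ : dist (s (k + D)) (s 0) ≡ k + D
            along-σ = subst (λ n → dist (s n) (s 0) ≡ k + D) (+-identityʳ (k + D))
                            (dist-along-ray σ (k + D) 0)
          base-side : dist (r M′) (r (k + K)) ≡ B
          base-side = subst (λ n → dist (r n) (r (k + K)) ≡ B) (+-comm B (k + K))
                            (dist-along-ray ρ B (k + K))
          base-total : dist (r M′) (s 0) ≡ B + dist (r (k + K)) (s 0)
          base-total =
            trans (dist-sym _ _) (trans s₀-far (cong (B +_) (trans (sym (h k)) (dist-sym _ _))))

      -- every path from beyond σ i to beyond ρ B passes through σ i
      diverges⇒inequivalent : Diverges → ¬ Equivalent E s r
      diverges⇒inequivalent (i , B , away) = finite-separator⇒inequivalent E separator meets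
        where
        separator : List V
        separator = applyDownFrom s (suc i) ++ applyDownFrom r (suc B)
        offset : ∀ {a b} → a ≤ b → Σ ℕ λ k → b ≡ k + a
        offset {a} {b} a≤b = b ∸ a , sym (m∸n+n≡m a≤b)
        meets : ∀ xs → IsPathBetween E s r xs → ¬ ¬ (Σ V λ x → x ∈ separator × x ∈ xs)
        meets xs (a , b , pft) with _ , refl , p ← IsPathFromTo⇒Path pft with i ≤? a | B ≤? b
        ... | no a<i | _ =
          pure (s a , ∈-++⁺ˡ (∈-applyDownFrom⁺ s (m<n⇒m<1+n (≰⇒> a<i))) , here refl)
        ... | yes _ | no b<B =
          pure (r b , ∈-++⁺ʳ (applyDownFrom s (suc i)) (∈-applyDownFrom⁺ r (m<n⇒m<1+n (≰⇒> b<B))) ,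
                path-end-∈ p)
        ... | yes i≤a | yes B≤b with k , refl ← offset i≤a | l , refl ← offset B≤b = do
          sᵢ≡ ← on-geodesic p (dist-along-ray σ k i) (receding-dist σ (away l) k)
          pure (s i , ∈-++⁺ˡ (∈-applyDownFrom⁺ s ≤-refl) ,
                subst (_∈ _) (sym sᵢ≡) (vertex-at-∈ k))

      equivalent⇒same-tail : Equivalent E s r → SameTail s r
      equivalent⇒same-tail equivalent =
        converges⇒same-tail
          (¬diverges⇒converges λ diverges → diverges⇒inequivalent diverges equivalent)

    converging-rays-equivalent : ∀ σ σ′ → Converges σ → Converges σ′ →
                                 Equivalent E (seq σ) (seq σ′)
    converging-rays-equivalent σ σ′ c c′ = same-tail⇒equivalent σ
      (same-tail-via {seq σ} {seq σ′} {r} (converges⇒same-tail σ c) (converges⇒same-tail σ′ c′))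

    all-but-one-diverge : ∀ {m} (σs : Fin (suc m) → Ray E) →
                          (∀ a b → a ≢ b → ¬ Equivalent E (seq (σs a)) (seq (σs b))) →
                          ¬ ¬ (Σ (Fin (suc m)) λ u → ∀ a → a ≢ u → Diverges (σs a))
    all-but-one-diverge {m} σs inequivalent =
      ¬¬-excluded-middle {A = Σ (Fin (suc m)) (Converges ∘ σs)} >>= λ where
        (yes (u , converges-u)) → do
          diverge ← ¬¬-Π-Fin _ λ a → ¬¬-→ λ a≢u ¬diverges → inequivalent a u a≢u
            (converging-rays-equivalent (σs a) (σs u)
              (¬diverges⇒converges (σs a) ¬diverges) converges-u)
          pure (u , diverge)
        (no none-converges) → do
          diverge ← ¬¬-Π-Fin _ λ a → ¬¬-→ λ _ ¬diverges →
            none-converges (a , ¬diverges⇒converges (σs a) ¬diverges)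
          pure (Fin.zero , diverge)

    Climbs : Ray E → ℕ → ℕ → ℕ → Set
    Climbs σ o M L = ∀ t → OnHorosphere (seq σ (t + o)) M (t + L)

    climbs-later : ∀ {σ o} → Climbs σ o M L → ∀ i → Climbs σ o (i + M) (i + L)
    climbs-later {L = L} c i t =
      subst (OnHorosphere _ _) (x∙yz≈y∙xz i t L) (on-horosphere-later (c t) i)

    climbs-skip : ∀ {σ o} → Climbs σ o M L → ∀ j → Climbs σ (j + o) M (j + L)
    climbs-skip {M = M} {L} {σ} {o} c j t =
      subst₂ (λ n → OnHorosphere (seq σ n) M) (+-assoc t j o) (+-assoc t j L) (c (t + j))

    diverges⇒climbs : ∀ σ → Diverges σ →
                      Eventually (λ M → Σ ℕ λ o → Σ ℕ λ L → Climbs σ o M L)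
    diverges⇒climbs σ (i , away) = M₀ , λ k → i , k + L₀ , climbs-later {σ = σ} climbs k
      where
      both : Eventually λ M → OnHorosphere (seq σ i) M (dist (seq σ i) (r M)) ×
                              Receding σ (r M) i
      both = eventually-∧ (eventually-on-horosphere (seq σ i)) away
      M₀ L₀ : ℕ
      M₀ = start both
      L₀ = dist (seq σ i) (r M₀)
      climbs : Climbs σ i M₀ L₀
      climbs t j = begin
        dist (seq σ (t + i)) (r (j + M₀)) ≡⟨ receding-dist σ (proj₂ (holds both j)) t ⟩
        t + dist (seq σ i) (r (j + M₀))   ≡⟨ cong (t +_) (proj₁ (holds both 0) j) ⟩
        t + (j + L₀)                      ≡⟨ x∙yz≈y∙xz t j L₀ ⟩
        j + (t + L₀)                      ∎
        where open ≡-Reasoning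

    module _ {σ σ′ : Ray E} {o o′ : ℕ} (c : Climbs σ o M L) (c′ : Climbs σ′ o′ M L) where
      private
        s s′ : ℕ → V
        s = seq σ
        s′ = seq σ′

      climbing-merge : ∀ t → s (suc t + o) ≡ s′ (suc t + o′) → ¬ ¬ (s (t + o) ≡ s′ (t + o′))
      climbing-merge t meet =
        closer-neighbour-unique (E-sym (adj σ (t + o)))
                                (subst (λ x → E x _) (sym meet) (E-sym (adj σ′ (t + o′))))
                                (trans (cong suc (c t 0)) (sym (c (suc t) 0)))
                                (trans (cong suc (c′ t 0)) (sym (c (suc t) 0)))

      climbing-merge-from : ∀ k t → s (k + t + o) ≡ s′ (k + t + o′) →
                            ¬ ¬ (s (t + o) ≡ s′ (t + o′))
      climbing-merge-from zero    t meet = pure meet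
      climbing-merge-from (suc k) t meet = climbing-merge (k + t) meet >>= climbing-merge-from k t

      climbing-rays-separate : ¬ Equivalent E s s′ →
                               ¬ ¬ Eventually (λ t → s (t + o) ≢ s′ (t + o′))
      climbing-rays-separate inequivalent = do
        t₀ , apart ← apart-somewhere
        pure (t₀ , λ k meet → climbing-merge-from k t₀ meet apart)
        where
        apart-somewhere : ¬ ¬ (Σ ℕ λ t → s (t + o) ≢ s′ (t + o′))
        apart-somewhere never =
          inequivalent (same-tail⇒equivalent σ (o , o′ , λ t apart → never (t , apart)))

    diverging-rays-climb-together :
      ∀ {m} (σs : Fin m → Ray E) → (∀ a → Diverges (σs a)) →
      Σ ℕ λ M → Σ ℕ λ H → ∀ a → Σ ℕ λ o → Climbs (σs a) o M H
    diverging-rays-climb-together σs diverge = start climb , start reach , holds reach 0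
      where
      climb : Eventually λ M → ∀ a → Σ ℕ λ o → Σ ℕ λ L → Climbs (σs a) o M L
      climb = eventually-∀-Fin (λ a → diverges⇒climbs (σs a) (diverge a))
      reach : Eventually λ H → ∀ a → Σ ℕ λ o → Climbs (σs a) o (start climb) H
      reach = eventually-∀-Fin λ a → let o , L₀ , c = holds climb 0 a in
                                     L₀ , λ j → j + o , climbs-skip {σ = σs a} c j

    diverging-rays-crowd-horosphere :
      ∀ {m} (σs : Fin m → Ray E) →
      (∀ a b → a ≢ b → ¬ Equivalent E (seq (σs a)) (seq (σs b))) → (∀ a → Diverges (σs a)) →
      ¬ ¬ (Σ ℕ λ M → Σ ℕ λ L → Σ (Fin m → V) λ y →
             (∀ a → OnHorosphere (y a) M L) × (∀ a b → a ≢ b → y a ≢ y b))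
    diverging-rays-crowd-horosphere σs inequivalent diverge = do
        separating ← ¬¬-Π-Fin _ λ a → ¬¬-Π-Fin _ (separation a)
        let t , separated = eventually-∀-Fin λ a → eventually-∀-Fin λ b →
                              eventually-→ (¬? (a Fin.≟ b)) (separating a b)
        pure (M₀ , t + H₀ , (λ a → vertex a t) , (λ a → proj₂ (climb a) t) , separated 0)
      where
      together : Σ ℕ λ M → Σ ℕ λ H → ∀ a → Σ ℕ λ o → Climbs (σs a) o M H
      together = diverging-rays-climb-together σs diverge
      M₀ H₀ : ℕ
      M₀ = proj₁ together
      H₀ = proj₁ (proj₂ together)
      climb : ∀ a → Σ ℕ λ o → Climbs (σs a) o M₀ H₀
      climb = proj₂ (proj₂ together)
      vertex : Fin _ → ℕ → V
      vertex a t = seq (σs a) (t + proj₁ (climb a))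
      separation : ∀ a b → ¬ ¬ (a ≢ b → Eventually λ t → vertex a t ≢ vertex b t)
      separation a b = ¬¬-→ λ a≢b →
        climbing-rays-separate {M = M₀} {L = H₀} {σ = σs a} {σ′ = σs b}
          (proj₂ (climb a)) (proj₂ (climb b)) (inequivalent a b a≢b)

module _ {c ℓ a e} (Γ : Group c ℓ) {V : Set a} {E : V → V → Set e} (tree : IsTree E)
         (A : ActionByAutomorphisms Γ E) where
  open Group Γ using (Carrier; _∙_; _⁻¹; inverseˡ)
  open ActionByAutomorphisms A
  open TreeGeometry tree

  private variable
    u v x : V
    xs : List V
    M L : ℕ

  act-inverse : ∀ g x → act (g ⁻¹) (act g x) ≡ x
  act-inverse g x = trans (sym (act-∙ (g ⁻¹) g x)) (trans (act-cong (inverseˡ g) x) (act-ε x))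

  act-injective : ∀ g {x y} → act g x ≡ act g y → x ≡ y
  act-injective g {x} {y} eq =
    trans (sym (act-inverse g x)) (trans (cong (act (g ⁻¹)) eq) (act-inverse g y))

  act-path : ∀ g → Path u v xs → Path (act g u) (act g v) (List.map (act g) xs)
  act-path {u} {xs = xs} g (lk , un , l) =
    Linkedₚ.map⁺ (Linked.map (act-adj g) lk) , Uniqueₚ.map⁺ (act-injective g) un ,
    trans (last-map (act g) (u ∷ xs)) (cong (Maybe.map (act g)) l)

  dist-invariant : ∀ g x y → dist (act g x) (act g y) ≡ dist x y
  dist-invariant g x y =
    trans (sym (path-length (act-path g (proj₂ (geodesic x y)))))
          (length-map (act g) (proj₁ (geodesic x y)))

  act-ray : Carrier → Ray E → Ray E
  act-ray g σ = record
    { seq = act g ∘ seq σ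
    ; adj = act-adj g ∘ adj σ
    ; inj = λ m n → inj σ m n ∘ act-injective g
    }

  module _ (ρ : Ray E) where
    open Horospheres ρ
    private
      r : ℕ → V
      r = seq ρ

    -- g maps ρ (k + D) to ρ (k + K), so it shifts all horospheres by K − D; preserving one forces D = K
    horosphere-preserving⇒fixes-vertex : ∀ g → Equivalent E (act g ∘ r) r →
      OnHorosphere x M L → OnHorosphere (act g x) M L → Σ ℕ λ K → ¬ ¬ (act g (r K) ≡ r K)
    horosphere-preserving⇒fixes-vertex {x} {M} {L} g equivalent on on-g = K , do
        moved ← tail M
        fixed ← tail 0
        pure (subst (λ n → act g (r n) ≡ r K) (D≡K moved) fixed)
      where
      open ≡-Reasoning
      same : SameTail (act g ∘ r) r
      same = equivalent⇒same-tail (act-ray g ρ) equivalent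
      D K : ℕ
      D = proj₁ same
      K = proj₁ (proj₂ same)
      tail : ∀ k → ¬ ¬ (act g (r (k + D)) ≡ r (k + K))
      tail = proj₂ (proj₂ same)
      D≡K : act g (r (M + D)) ≡ r (M + K) → D ≡ K
      D≡K moved = +-cancelʳ-≡ L D K (begin
        D + L                               ≡⟨ on D ⟨
        dist x (r (D + M))                  ≡⟨ cong (dist x ∘ r) (+-comm D M) ⟩
        dist x (r (M + D))                  ≡⟨ dist-invariant g x _ ⟨
        dist (act g x) (act g (r (M + D)))  ≡⟨ cong (dist (act g x)) moved ⟩
        dist (act g x) (r (M + K))          ≡⟨ cong (dist (act g x) ∘ r) (+-comm M K) ⟩
        dist (act g x) (r (K + M))          ≡⟨ on-g K ⟩
        K + L                               ∎)

  module _ (ρ : Ray E) (stabilizes : ∀ g → Equivalent E (act g ∘ seq ρ) (seq ρ))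
           (free : Free Γ E A) where
    open Horospheres ρ

    horosphere-meets-orbit-once : ∀ g → OnHorosphere x M L → OnHorosphere (act g x) M L →
                                  ¬ ¬ (act g x ≡ x)
    horosphere-meets-orbit-once {x} g on on-g = do
      let K , fixes = horosphere-preserving⇒fixes-vertex ρ g (stabilizes g) on on-g
      fixed ← fixes
      pure (trans (act-cong (free g (seq ρ K) fixed) x) (act-ε x))

    ¬distinct-on-horosphere :
      ∀ ((n , rep , orbit) : QuasiTransitive Γ E A) (y : Fin (suc n) → V) →
      (∀ a → OnHorosphere (y a) M L) → ¬ (∀ a b → a ≢ b → y a ≢ y b)
    ¬distinct-on-horosphere {M} {L} (n , rep , orbit) y on distinct =
      horosphere-meets-orbit-once g (on i) (subst (λ v → OnHorosphere v M L) (sym moves) (on j))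
        λ fixed → distinct i j (Finₚ.<⇒≢ i<j) (trans (sym fixed) moves)
      where
      open ≡-Reasoning
      index : V → Fin n
      index v = proj₁ (orbit v)
      mover : V → Carrier
      mover v = proj₁ (proj₂ (orbit v))
      moves-rep : ∀ v → act (mover v) (rep (index v)) ≡ v
      moves-rep v = proj₂ (proj₂ (orbit v))
      collision : Σ (Fin (suc n)) λ i → Σ (Fin (suc n)) λ j → i Fin.< j × index (y i) ≡ index (y j)
      collision = Finₚ.pigeonhole (n<1+n n) (index ∘ y)
      i j : Fin (suc n)
      i = proj₁ collision
      j = proj₁ (proj₂ collision)
      i<j : i Fin.< j
      i<j = proj₁ (proj₂ (proj₂ collision))
      same-orbit : index (y i) ≡ index (y j)
      same-orbit = proj₂ (proj₂ (proj₂ collision))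
      gⁱ gʲ g : Carrier
      gⁱ = mover (y i)
      gʲ = mover (y j)
      g = gʲ ∙ gⁱ ⁻¹
      moves : act g (y i) ≡ y j
      moves = begin
        act (gʲ ∙ gⁱ ⁻¹) (y i)                         ≡⟨ act-∙ gʲ (gⁱ ⁻¹) (y i) ⟩
        act gʲ (act (gⁱ ⁻¹) (y i))                     ≡⟨ cong (act gʲ ∘ act (gⁱ ⁻¹)) (moves-rep (y i)) ⟨
        act gʲ (act (gⁱ ⁻¹) (act gⁱ (rep (index (y i))))) ≡⟨ cong (act gʲ) (act-inverse gⁱ _) ⟩
        act gʲ (rep (index (y i)))                     ≡⟨ cong (act gʲ ∘ rep) same-orbit ⟩
        act gʲ (rep (index (y j)))                     ≡⟨ moves-rep (y j) ⟩
        y j                                            ∎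

lemma4p3 : {c ℓ a e : Level} (Γ : Group c ℓ) {V : Set a} (E : V → V → Set e)
           → IsTree E → InfinitelyManyEnds E
           → (A : ActionByAutomorphisms Γ E)
           → QuasiTransitive Γ E A → StabilizesAnEnd Γ E A
           → ¬ Free Γ E A
lemma4p3 Γ E tree ends A quasi-transitive@(n , _) (ρ , stabilizes) free =
  all-but-one-diverge ρs inequivalent λ (u , diverge) →
  diverging-rays-crowd-horosphere (ρs ∘ Fin.punchIn u)
    (λ a b a≢b → inequivalent _ _ (a≢b ∘ Finₚ.punchIn-injective u a b))
    (λ a → diverge _ (Finₚ.punchInᵢ≢i u a)) λ (_ , _ , y , on , distinct) →
  ¬distinct-on-horosphere Γ tree A ρ stabilizes free quasi-transitive y on distinct
  where
  open TreeGeometry tree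
  open Horospheres ρ
  ρs : Fin (suc (suc n)) → Ray E
  ρs = proj₁ (ends (suc (suc n)))
  inequivalent : ∀ a b → a ≢ b → ¬ Equivalent E (seq (ρs a)) (seq (ρs b))
  inequivalent = proj₂ (ends (suc (suc n)))
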